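{- Let $M\in\{0,1\}^{m\times n}$ be the vertex-edge incidence matrix of a simple graph and $c\in\mathbb Z^n$. The function $f_{c,M}:\mathbb Z^m\to\mathbb Z\cup\{\infty\}$, $f_{c,M}(z)=\min\{c^\top x\mid Mx=z,\ x\in\mathbb Z^n_{\ge 0}\}$ (with $\min\emptyset=\infty$), is SBO jump M-convex.
   Context: For $x,y\in\mathbb Z^m$, write $x\sqsubseteq y$ if $|x_i|\le|y_i|$ and $x_iy_i\ge 0$ for all $i$. A $2$-step decomposition of $d\in\mathbb Z^m$ is a multiset of vectors $p^{(1)},\dots,p^{(\ell)}\in\mathbb Z^m$ with $\|p^{(k)}\|_1=2$ and $p^{(k)}\sqsubseteq d$ for all $k$, and $d=\sum_k p^{(k)}$. A function $f:\mathbb Z^m\to\mathbb Q\cup\{\infty\}$ is SBO jump M-convex if for any two points $z^{(1)},z^{(2)}$ with $f(z^{(1)}),f(z^{(2)})<\infty$ there exist a $2$-step decomposition $p^{(1)},\dots,p^{(\ell)}$ of $z^{(2)}-z^{(1)}$ and reals $g^{(1)},\dots,g^{(\ell)}$ such that $f(z^{(2)})=f(z^{(1)})+\sum_{k\in[\ell]}g^{(k)}$ and, for every $I\subseteq[\ell]$, $f(z^{(1)}+\sum_{k\in I}p^{(k)})\le f(z^{(1)})+\sum_{k\in I}g^{(k)}$. -}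

module Defs where

open import Data.Nat using (ℕ; zero; suc)
open import Data.Fin using (Fin; zero; suc; _≟_)
open import Data.Integer as ℤ using (ℤ; +_; ∣_∣)
open import Data.Rational as ℚ using (ℚ)
open import Data.Bool using (Bool; true; false; if_then_else_; _∨_)
open import Data.Maybe using (Maybe; just; nothing)
open import Data.Product using (Σ; ∃; _×_; _,_)
open import Data.Sum using (_⊎_)
open import Relation.Nullary using (¬_)
open import Relation.Nullary.Decidable using (⌊_⌋)
open import Relation.Binary.PropositionalEquality using (_≡_; _≢_)

sumℤ : ∀ {n} → (Fin n → ℤ) → ℤ
sumℤ {zero}  a = + 0
sumℤ {suc n} a = a zero ℤ.+ sumℤ (λ k → a (suc k))

sumℚ : ∀ {n} → (Fin n → ℚ) → ℚ
sumℚ {zero}  a = ℚ.0ℚ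
sumℚ {suc n} a = a zero ℚ.+ sumℚ (λ k → a (suc k))

toℚ : ℤ → ℚ
toℚ z = z ℚ./ 1

Vecℤ : ℕ → Set
Vecℤ m = Fin m → ℤ

_⊑_ : ∀ {m} → Vecℤ m → Vecℤ m → Set
x ⊑ y = ∀ i → (∣ x i ∣ Data.Nat.≤ ∣ y i ∣) × (+ 0 ℤ.≤ x i ℤ.* y i)

norm1 : ∀ {m} → Vecℤ m → ℕ
norm1 x = ∣ sumℤ (λ i → + ∣ x i ∣) ∣

sumSub : ∀ {ℓ m} → (Fin ℓ → Bool) → (Fin ℓ → Vecℤ m) → Vecℤ m
sumSub I p i = sumℤ (λ k → if I k then p k i else + 0)

sumSubℚ : ∀ {ℓ} → (Fin ℓ → Bool) → (Fin ℓ → ℚ) → ℚ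
sumSubℚ I g = sumℚ (λ k → if I k then g k else ℚ.0ℚ)

IsTwoStepDecomposition : ∀ {m ℓ} → Vecℤ m → (Fin ℓ → Vecℤ m) → Set
IsTwoStepDecomposition d p =
  (∀ k → norm1 (p k) ≡ 2) × (∀ k → p k ⊑ d) × (∀ i → d i ≡ sumℤ (λ k → p k i))

-- SBO jump M-convexity of f : ℤ^m → ℚ ∪ {∞}  (∞ = nothing)
SBOJumpMConvex : ∀ {m} → (Vecℤ m → Maybe ℚ) → Set
SBOJumpMConvex {m} f =
  ∀ (z₁ z₂ : Vecℤ m) (v₁ v₂ : ℚ) → f z₁ ≡ just v₁ → f z₂ ≡ just v₂ →
  Σ ℕ λ ℓ → Σ (Fin ℓ → Vecℤ m) λ p → Σ (Fin ℓ → ℚ) λ g →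
    IsTwoStepDecomposition (λ i → z₂ i ℤ.- z₁ i) p
    × v₂ ≡ v₁ ℚ.+ sumℚ g
    × (∀ (I : Fin ℓ → Bool) → Σ ℚ λ w →
         (f (λ i → z₁ i ℤ.+ sumSub I p i) ≡ just w) × (w ℚ.≤ v₁ ℚ.+ sumSubℚ I g))

incidenceEntry : ∀ {m n} → (Fin n → Fin m) → (Fin n → Fin m) → Fin m → Fin n → ℤ
incidenceEntry u v i e = if ⌊ i ≟ u e ⌋ ∨ ⌊ i ≟ v e ⌋ then + 1 else + 0

-- M ∈ {0,1}^{m×n} is the vertex-edge incidence matrix of a simple graph
-- on vertex set Fin m with edge set Fin n: edge e joins u e ≠ v e, and
-- distinct edges have distinct endpoint sets (no parallel edges).
IsSimpleGraphIncidence : ∀ {m n} → (Fin m → Fin n → ℤ) → Set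
IsSimpleGraphIncidence {m} {n} M =
  Σ (Fin n → Fin m) λ u → Σ (Fin n → Fin m) λ v →
    (∀ e → u e ≢ v e)
    × (∀ e e' → ((u e ≡ u e' × v e ≡ v e') ⊎ (u e ≡ v e' × v e ≡ u e')) → e ≡ e')
    × (∀ i e → M i e ≡ incidenceEntry u v i e)

Feasible : ∀ {m n} → (Fin m → Fin n → ℤ) → Vecℤ m → (Fin n → ℕ) → Set
Feasible M z x = ∀ i → sumℤ (λ e → M i e ℤ.* + x e) ≡ z i

cost : ∀ {n} → (Fin n → ℤ) → (Fin n → ℕ) → ℤ
cost c x = sumℤ (λ e → c e ℤ.* + x e)

IsMinValue : ∀ {m n} → (Fin n → ℤ) → (Fin m → Fin n → ℤ) → Vecℤ m → Maybe ℤ → Set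
IsMinValue c M z nothing  = ¬ Σ _ (Feasible M z)
IsMinValue c M z (just r) =
  Σ _ (λ x → Feasible M z x × cost c x ≡ r)
  × (∀ x → Feasible M z x → r ℤ.≤ cost c x)

module Submission where

-- Let x₁, x₂ be optimal for z₁, z₂ and Y = x₂ − x₁. Adding the signed edge units of Y
-- one at a time, Y splits into vectors conformal to Y (of the sign of Y on every edge):
-- a circulation w (M w = 0) and pieces q_k with M q_k = ±e_a ± e_b. A new edge is
-- joined to a piece ending with the opposite sign at its endpoint, and a piece whose
-- two ends cancel moves into w; so at each vertex all piece ends have one sign, which
-- gives ‖p_k‖₁ = 2 and p_k ⊑ z₂ − z₁ for p_k = M q_k. By conformality x₁ + w + Σ_{k∈I} q_k
-- lies between x₁ and x₂, hence is feasible for z₁ + Σ_{k∈I} p_k. Comparing x₁ with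
-- x₁ + w and x₂ with x₂ − w gives c·w = 0, so g_k = c·q_k works.

open import Defs
open import Data.Bool using (Bool; true; false; if_then_else_; not)
import Data.Bool.Properties as Boolₚ
open import Data.Empty using (⊥-elim)
open import Data.Fin using (Fin; zero; suc; _≟_; punchIn)
import Data.Fin.Properties as Finₚ
open import Data.Integer as ℤ using (ℤ; +_; -[1+_]; +[1+_]; ∣_∣; _+_; _*_; -_; _-_; _≤_; +≤+; -≤+)
import Data.Integer.Properties as ℤₚ
open import Data.Integer.Tactic.RingSolver using (solve-∀)
open import Data.List using (List; []; _∷_; length; lookup)
open import Data.List.Membership.Propositional.Properties using (∈-lookup)
open import Data.List.Relation.Unary.All as All using (All; []; _∷_)
open import Data.Maybe using (Maybe; just; nothing; map)
open import Data.Nat as ℕ using (ℕ; zero; suc)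
import Data.Nat.Properties as ℕₚ
open import Data.Product using (Σ; ∃₂; _×_; _,_; proj₁; proj₂)
import Data.Product.Properties as ×ₚ
open import Data.Rational as ℚ using (ℚ; toℚᵘ)
import Data.Rational.Properties as ℚₚ
open import Data.Rational.Unnormalised as ℚᵘ using (mkℚᵘ; *≡*; *≤*)
import Data.Rational.Unnormalised.Properties as ℚᵘₚ
open import Data.Sum using (_⊎_; inj₁; inj₂)
open import Data.Vec.Functional using (removeAt; updateAt)
open import Data.Vec.Functional.Properties using (updateAt-updates; updateAt-minimal)
open import Function using (_∘_; const)
open import Relation.Nullary using (Dec; yes; no; contradiction)
open import Relation.Nullary.Decidable using (⌊_⌋)
open import Relation.Binary.PropositionalEquality
open ≡-Reasoning

import Algebra.Properties.Semiring.Sum as SemiringSum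
module ℤΣ = SemiringSum ℤₚ.+-*-semiring
module ℕΣ = SemiringSum ℕₚ.+-*-semiring
open import Algebra.Properties.CommutativeSemigroup ℤₚ.+-commutativeSemigroup using (x∙yz≈y∙xz)

sumℤ≡sum : ∀ {n} (a : Fin n → ℤ) → sumℤ a ≡ ℤΣ.sum a
sumℤ≡sum {zero}  a = refl
sumℤ≡sum {suc n} a = cong (_+_ (a zero)) (sumℤ≡sum (a ∘ suc))

sumℤ-cong : ∀ {n} {a b : Fin n → ℤ} → (∀ k → a k ≡ b k) → sumℤ a ≡ sumℤ b
sumℤ-cong {a = a} {b} a≗b =
  trans (sumℤ≡sum a) (trans (ℤΣ.sum-cong-≗ a≗b) (sym (sumℤ≡sum b)))

sumℤ-zero : ∀ {n} → sumℤ {n} (λ _ → + 0) ≡ + 0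
sumℤ-zero {n} = trans (sumℤ≡sum {n} (const (+ 0))) (ℤΣ.sum-replicate-zero n)

sumℤ-+ : ∀ {n} (a b : Fin n → ℤ) → sumℤ (λ k → a k + b k) ≡ sumℤ a + sumℤ b
sumℤ-+ a b = begin
  sumℤ (λ k → a k + b k)       ≡⟨ sumℤ≡sum (λ k → a k + b k) ⟩
  ℤΣ.sum (λ k → a k + b k)     ≡⟨ ℤΣ.∑-distrib-+ a b ⟩
  ℤΣ.sum a + ℤΣ.sum b          ≡⟨ cong₂ _+_ (sumℤ≡sum a) (sumℤ≡sum b) ⟨
  sumℤ a + sumℤ b              ∎

*-distribˡ-sumℤ : ∀ {n} x (a : Fin n → ℤ) → x * sumℤ a ≡ sumℤ (λ k → x * a k)
*-distribˡ-sumℤ x a = begin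
  x * sumℤ a                   ≡⟨ cong (x *_) (sumℤ≡sum a) ⟩
  x * ℤΣ.sum a                 ≡⟨ ℤΣ.*-distribˡ-sum x a ⟩
  ℤΣ.sum (λ k → x * a k)       ≡⟨ sumℤ≡sum (λ k → x * a k) ⟨
  sumℤ (λ k → x * a k)         ∎

sumℤ-comm : ∀ {k l} (F : Fin k → Fin l → ℤ) →
            sumℤ (λ i → sumℤ (F i)) ≡ sumℤ (λ j → sumℤ (λ i → F i j))
sumℤ-comm F = begin
  sumℤ (λ i → sumℤ (F i))                  ≡⟨ sumℤ-cong (λ i → sumℤ≡sum (F i)) ⟩
  sumℤ (λ i → ℤΣ.sum (F i))                ≡⟨ sumℤ≡sum (λ i → ℤΣ.sum (F i)) ⟩
  ℤΣ.sum (λ i → ℤΣ.sum (F i))              ≡⟨ ℤΣ.∑-comm F ⟩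
  ℤΣ.sum (λ j → ℤΣ.sum (λ i → F i j))      ≡⟨ sumℤ≡sum (λ j → ℤΣ.sum (λ i → F i j)) ⟨
  sumℤ (λ j → ℤΣ.sum (λ i → F i j))        ≡⟨ sumℤ-cong (λ j → sumℤ≡sum (λ i → F i j)) ⟨
  sumℤ (λ j → sumℤ (λ i → F i j))          ∎

sumℤ-remove : ∀ {n} (a : Fin (suc n) → ℤ) (k : Fin (suc n)) →
              sumℤ a ≡ a k + sumℤ (removeAt a k)
sumℤ-remove a k = begin
  sumℤ a                         ≡⟨ sumℤ≡sum a ⟩
  ℤΣ.sum a                       ≡⟨ ℤΣ.sum-remove {i = k} a ⟩
  a k + ℤΣ.sum (removeAt a k)    ≡⟨ cong (_+_ (a k)) (sumℤ≡sum (removeAt a k)) ⟨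
  a k + sumℤ (removeAt a k)      ∎

sumℤ-indicator : ∀ {n} (j : Fin n) (a : Fin n → ℤ) →
                 sumℤ (λ k → if ⌊ k ≟ j ⌋ then a k else + 0) ≡ a j
sumℤ-indicator {suc n} j a = begin
  sumℤ χ                           ≡⟨ sumℤ-remove χ j ⟩
  χ j + sumℤ (removeAt χ j)        ≡⟨ cong₂ _+_ χ-on (trans (sumℤ-cong χ-off) (sumℤ-zero {n})) ⟩
  a j + + 0                        ≡⟨ ℤₚ.+-identityʳ (a j) ⟩
  a j                              ∎
  where
  χ : Fin (suc n) → ℤ
  χ k = if ⌊ k ≟ j ⌋ then a k else + 0
  χ-on : χ j ≡ a j
  χ-on with j ≟ j
  ... | yes _   = refl
  ... | no j≢j = contradiction refl j≢j
  χ-off : ∀ k → removeAt χ j k ≡ + 0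
  χ-off k with punchIn j k ≟ j
  ... | yes k′≡j = contradiction k′≡j (Finₚ.punchInᵢ≢i j k)
  ... | no _     = refl

sumSubℤ : ∀ {ℓ} → (Fin ℓ → Bool) → (Fin ℓ → ℤ) → ℤ
sumSubℤ I a = sumℤ (λ k → if I k then a k else + 0)

sumSubℤ-cong : ∀ {ℓ} (I : Fin ℓ → Bool) {a b : Fin ℓ → ℤ} → (∀ k → a k ≡ b k) →
               sumSubℤ I a ≡ sumSubℤ I b
sumSubℤ-cong I a≗b = sumℤ-cong (λ k → cong (λ x → if I k then x else + 0) (a≗b k))

sumSubℤ-complement : ∀ {ℓ} (I : Fin ℓ → Bool) (a : Fin ℓ → ℤ) →
                     sumSubℤ I a + sumSubℤ (not ∘ I) a ≡ sumℤ a
sumSubℤ-complement {ℓ} I a = begin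
  sumSubℤ I a + sumSubℤ (not ∘ I) a      ≡⟨ sumℤ-+ (masked I) (masked (not ∘ I)) ⟨
  sumℤ (λ k → masked I k + masked (not ∘ I) k) ≡⟨ sumℤ-cong (λ k → split (I k) (a k)) ⟩
  sumℤ a                                 ∎
  where
  masked : (Fin ℓ → Bool) → Fin ℓ → ℤ
  masked J k = if J k then a k else + 0
  split : ∀ b x → (if b then x else + 0) + (if not b then x else + 0) ≡ x
  split true  x = ℤₚ.+-identityʳ x
  split false x = ℤₚ.+-identityˡ x

infix 7 _·_

_·_ : ∀ {n} → (Fin n → ℤ) → (Fin n → ℤ) → ℤ
a · x = sumℤ (λ e → a e * x e)

·-cong : ∀ {n} (a : Fin n → ℤ) {x y : Fin n → ℤ} → (∀ e → x e ≡ y e) → a · x ≡ a · y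
·-cong a x≗y = sumℤ-cong (λ e → cong (a _ *_) (x≗y e))

·-+ : ∀ {n} (a x y : Fin n → ℤ) → a · (λ e → x e + y e) ≡ a · x + a · y
·-+ a x y = trans (sumℤ-cong (λ e → ℤₚ.*-distribˡ-+ (a e) (x e) (y e)))
  (sumℤ-+ (λ e → a e * x e) (λ e → a e * y e))

·-zero : ∀ {n} (a : Fin n → ℤ) → a · (λ _ → + 0) ≡ + 0
·-zero {n} a = trans (sumℤ-cong (λ e → ℤₚ.*-zeroʳ (a e))) (sumℤ-zero {n})

·-∣∣ : ∀ {n} (a X : Fin n → ℤ) → (∀ e → + 0 ≤ X e) → a · (λ e → + ∣ X e ∣) ≡ a · X
·-∣∣ a X X≥0 = ·-cong a (λ e → ℤₚ.0≤i⇒+∣i∣≡i (X≥0 e))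

·-sumSub : ∀ {n ℓ} (a : Fin n → ℤ) (I : Fin ℓ → Bool) (q : Fin ℓ → Fin n → ℤ) →
           a · sumSub I q ≡ sumSubℤ I (λ k → a · q k)
·-sumSub {n} {ℓ} a I q = begin
  a · sumSub I q                               ≡⟨ sumℤ-cong (λ e → *-distribˡ-sumℤ (a e) (λ k → qᴵ k e)) ⟩
  sumℤ (λ e → sumℤ (λ k → a e * qᴵ k e))       ≡⟨ sumℤ-comm (λ e k → a e * qᴵ k e) ⟩
  sumℤ (λ k → a · qᴵ k)                        ≡⟨ sumℤ-cong (λ k → pull (I k) k) ⟩
  sumSubℤ I (λ k → a · q k)                    ∎
  where
  qᴵ : Fin ℓ → Fin n → ℤ
  qᴵ k e = if I k then q k e else + 0
  pull : ∀ b k → sumℤ (λ e → a e * (if b then q k e else + 0)) ≡ (if b then a · q k else + 0)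
  pull true  k = refl
  pull false k = ·-zero a

toℚᵘ-toℚ : ∀ z → toℚᵘ (toℚ z) ℚᵘ.≃ mkℚᵘ z 0
toℚᵘ-toℚ z = ℚₚ.toℚᵘ-fromℚᵘ (mkℚᵘ z 0)

toℚ-+ : ∀ a b → toℚ (a + b) ≡ toℚ a ℚ.+ toℚ b
toℚ-+ a b = ℚₚ.toℚᵘ-injective (ℚᵘₚ.≃-trans (toℚᵘ-toℚ (a + b)) (ℚᵘₚ.≃-sym
  (ℚᵘₚ.≃-trans (ℚₚ.toℚᵘ-homo-+ (toℚ a) (toℚ b))
    (ℚᵘₚ.≃-trans (ℚᵘₚ.+-cong (toℚᵘ-toℚ a) (toℚᵘ-toℚ b)) (*≡* (numerator a b))))))
  where
  numerator : ∀ (a b : ℤ) → ((a * + 1) + (b * + 1)) * + 1 ≡ (a + b) * + 1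
  numerator = solve-∀

toℚ-mono-≤ : ∀ {a b} → a ≤ b → toℚ a ℚ.≤ toℚ b
toℚ-mono-≤ {a} {b} a≤b = ℚₚ.toℚᵘ-cancel-≤
  (ℚᵘₚ.≤-respˡ-≃ (ℚᵘₚ.≃-sym (toℚᵘ-toℚ a))
    (ℚᵘₚ.≤-respʳ-≃ (ℚᵘₚ.≃-sym (toℚᵘ-toℚ b))
      (*≤* (subst₂ _≤_ (sym (ℤₚ.*-identityʳ a)) (sym (ℤₚ.*-identityʳ b)) a≤b))))

toℚ-sumSubℤ : ∀ {ℓ} (I : Fin ℓ → Bool) (a : Fin ℓ → ℤ) →
              toℚ (sumSubℤ I a) ≡ sumSubℚ I (λ k → toℚ (a k))
toℚ-sumSubℤ {zero}  I a = refl
toℚ-sumSubℤ {suc ℓ} I a =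
  trans (toℚ-+ (if I zero then a zero else + 0) (sumSubℤ (I ∘ suc) (a ∘ suc)))
        (cong₂ ℚ._+_ (toℚ-if (I zero)) (toℚ-sumSubℤ (I ∘ suc) (a ∘ suc)))
  where
  toℚ-if : ∀ b → toℚ (if b then a zero else + 0) ≡ (if b then toℚ (a zero) else ℚ.0ℚ)
  toℚ-if true  = refl
  toℚ-if false = refl

Conformal : ℤ → ℤ → Set
Conformal a t = (+ 0 ≤ t → + 0 ≤ a) × (t ≤ + 0 → a ≤ + 0)

conformal-refl : ∀ t → Conformal t t
conformal-refl t = (λ 0≤t → 0≤t) , (λ t≤0 → t≤0)

conformal-0 : ∀ t → Conformal (+ 0) t
conformal-0 t = (λ _ → +≤+ ℕ.z≤n) , (λ _ → +≤+ ℕ.z≤n)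

conformal-+ : ∀ {a b t} → Conformal a t → Conformal b t → Conformal (a + b) t
conformal-+ (a₊ , a₋) (b₊ , b₋) =
  (λ 0≤t → ℤₚ.+-mono-≤ (a₊ 0≤t) (b₊ 0≤t)) , (λ t≤0 → ℤₚ.+-mono-≤ (a₋ t≤0) (b₋ t≤0))

conformal-sumSubℤ : ∀ {ℓ t} (I : Fin ℓ → Bool) (a : Fin ℓ → ℤ) →
                    (∀ k → Conformal (a k) t) → Conformal (sumSubℤ I a) t
conformal-sumSubℤ {zero}  {t} I a _  = conformal-0 t
conformal-sumSubℤ {suc ℓ} {t} I a a≼t = conformal-+ (head (I zero))
  (conformal-sumSubℤ (I ∘ suc) (a ∘ suc) (a≼t ∘ suc))
  where
  head : ∀ b → Conformal (if b then a zero else + 0) t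
  head true  = a≼t zero
  head false = conformal-0 t

conformal-sumℤ : ∀ {ℓ t} (a : Fin ℓ → ℤ) → (∀ k → Conformal (a k) t) → Conformal (sumℤ a) t
conformal-sumℤ = conformal-sumSubℤ (const true)

conformal-pos : ∀ {j t x} → Conformal +[1+ j ] t → + 0 ≤ x → Conformal x t
conformal-pos (_ , pos₋) 0≤x = (λ _ → 0≤x) , (λ t≤0 → contradiction (pos₋ t≤0) λ { (+≤+ ()) })

conformal-neg : ∀ {j t x} → Conformal -[1+ j ] t → x ≤ + 0 → Conformal x t
conformal-neg (neg₊ , _) x≤0 = (λ 0≤t → contradiction (neg₊ 0≤t) λ ()) , (λ _ → x≤0)

conformal-partial-nonneg : ∀ {x t a b} → + 0 ≤ x → + 0 ≤ x + t →
  Conformal a t → Conformal b t → a + b ≡ t → + 0 ≤ x + a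
conformal-partial-nonneg {x} {t} {a} {b} 0≤x 0≤x+t (a₊ , _) (_ , b₋) a+b≡t
  with ℤₚ.≤-total (+ 0) t
... | inj₁ 0≤t = ℤₚ.+-mono-≤ 0≤x (a₊ 0≤t)
... | inj₂ t≤0 = ℤₚ.≤-trans 0≤x+t (ℤₚ.≤-trans (ℤₚ.≤-reflexive regroup)
  (ℤₚ.≤-trans (ℤₚ.+-monoʳ-≤ (x + a) (b₋ t≤0)) (ℤₚ.≤-reflexive (ℤₚ.+-identityʳ (x + a)))))
  where
  regroup : x + t ≡ (x + a) + b
  regroup = trans (cong (_+_ x) (sym a+b≡t)) (sym (ℤₚ.+-assoc x a b))

∣+∣-nonneg : ∀ {a b} → + 0 ≤ a → + 0 ≤ b → ∣ a + b ∣ ≡ ∣ a ∣ ℕ.+ ∣ b ∣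
∣+∣-nonneg (+≤+ _) (+≤+ _) = refl

*-nonneg : ∀ {a b} → + 0 ≤ a → + 0 ≤ b → + 0 ≤ a * b
*-nonneg {+ α} {+ β} _ _ = subst (+ 0 ≤_) (sym (ℤₚ.+◃n≡+n (α ℕ.* β))) (+≤+ ℕ.z≤n)

∣+∣-conformal : ∀ {a b t} → Conformal a t → Conformal b t → ∣ a + b ∣ ≡ ∣ a ∣ ℕ.+ ∣ b ∣
∣+∣-conformal {a} {b} {t} (a₊ , a₋) (b₊ , b₋) with ℤₚ.≤-total (+ 0) t
... | inj₁ 0≤t = ∣+∣-nonneg (a₊ 0≤t) (b₊ 0≤t)
... | inj₂ t≤0 = begin
  ∣ a + b ∣                ≡⟨ ℤₚ.∣-i∣≡∣i∣ (a + b) ⟨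
  ∣ - (a + b) ∣            ≡⟨ cong ∣_∣ (ℤₚ.neg-distrib-+ a b) ⟩
  ∣ - a + - b ∣            ≡⟨ ∣+∣-nonneg (ℤₚ.neg-mono-≤ (a₋ t≤0)) (ℤₚ.neg-mono-≤ (b₋ t≤0)) ⟩
  ∣ - a ∣ ℕ.+ ∣ - b ∣      ≡⟨ cong₂ ℕ._+_ (ℤₚ.∣-i∣≡∣i∣ a) (ℤₚ.∣-i∣≡∣i∣ b) ⟩
  ∣ a ∣ ℕ.+ ∣ b ∣          ∎

*-conformal-nonneg : ∀ {a b t} → Conformal a t → Conformal b t → + 0 ≤ a * b
*-conformal-nonneg {a} {b} {t} (a₊ , a₋) (b₊ , b₋) with ℤₚ.≤-total (+ 0) t
... | inj₁ 0≤t = *-nonneg (a₊ 0≤t) (b₊ 0≤t)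
... | inj₂ t≤0 = subst (+ 0 ≤_) (neg*neg a b)
  (*-nonneg (ℤₚ.neg-mono-≤ (a₋ t≤0)) (ℤₚ.neg-mono-≤ (b₋ t≤0)))
  where
  neg*neg : ∀ (a b : ℤ) → (- a) * (- b) ≡ a * b
  neg*neg = solve-∀

summand-⊑-sum : ∀ {ℓ} (a : Fin ℓ → ℤ) t → (∀ k → Conformal (a k) t) →
                ∀ k → (∣ a k ∣ ℕ.≤ ∣ sumℤ a ∣) × (+ 0 ≤ a k * sumℤ a)
summand-⊑-sum {suc ℓ} a t a≼t k rewrite sumℤ-remove a k =
  ℕₚ.≤-trans (ℕₚ.m≤m+n _ _) (ℕₚ.≤-reflexive (sym (∣+∣-conformal (a≼t k) rest≼t))) ,
  *-conformal-nonneg (a≼t k) (conformal-+ (a≼t k) rest≼t)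
  where
  rest≼t : Conformal (sumℤ (removeAt a k)) t
  rest≼t = conformal-sumℤ (removeAt a k) (a≼t ∘ punchIn k)

sg : Bool → ℤ
sg true  = + 1
sg false = -[1+ 0 ]

opposite : ∀ {k} → Bool × Fin k → Bool × Fin k
opposite (σ , j) = not σ , j

δ : ∀ {k} → Bool × Fin k → Fin k → ℤ
δ (σ , j) i = if ⌊ i ≟ j ⌋ then sg σ else + 0

δ-opposite : ∀ {k} (τ : Bool × Fin k) i → δ τ i + δ (opposite τ) i ≡ + 0
δ-opposite (σ , j) i with i ≟ j
δ-opposite (true  , j) i | yes _ = refl
δ-opposite (false , j) i | yes _ = refl
... | no _ = refl

sumℤ-∣δ∣ : ∀ {k} (τ : Bool × Fin k) → sumℤ (λ i → + ∣ δ τ i ∣) ≡ + 1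
sumℤ-∣δ∣ (σ , j) = trans (sumℤ-cong ∣δ∣) (sumℤ-indicator j (const (+ 1)))
  where
  ∣sg∣ : ∀ σ → + ∣ sg σ ∣ ≡ + 1
  ∣sg∣ true  = refl
  ∣sg∣ false = refl
  ∣δ∣ : ∀ i → + ∣ δ (σ , j) i ∣ ≡ (if ⌊ i ≟ j ⌋ then + 1 else + 0)
  ∣δ∣ i with i ≟ j
  ... | yes _ = ∣sg∣ σ
  ... | no _  = refl

·-δ : ∀ {n} (a : Fin n → ℤ) (σ : Bool) (e : Fin n) → a · δ (σ , e) ≡ a e * sg σ
·-δ a σ e = trans (sumℤ-cong (λ k → *-if (a k) ⌊ k ≟ e ⌋)) (sumℤ-indicator e (λ k → a k * sg σ))
  where
  *-if : ∀ x b → x * (if b then sg σ else + 0) ≡ (if b then x * sg σ else + 0)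
  *-if x true  = refl
  *-if x false = ℤₚ.*-zeroʳ x

incidenceEntry-δ : ∀ {m n} (u v : Fin n → Fin m) (e : Fin n) → u e ≢ v e → ∀ σ i →
  incidenceEntry u v i e * sg σ ≡ δ (σ , u e) i + δ (σ , v e) i
incidenceEntry-δ u v e u≢v σ i with i ≟ u e | i ≟ v e
... | yes i≡u | yes i≡v = ⊥-elim (u≢v (trans (sym i≡u) i≡v))
... | yes _   | no _    = trans (ℤₚ.*-identityˡ (sg σ)) (sym (ℤₚ.+-identityʳ (sg σ)))
... | no _    | yes _   = trans (ℤₚ.*-identityˡ (sg σ)) (sym (ℤₚ.+-identityˡ (sg σ)))
... | no _    | no _    = ℤₚ.*-zeroˡ (sg σ)

Agrees : ∀ {m} → (Fin m → Bool) → Bool × Fin m → Set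
Agrees Φ (σ , j) = σ ≡ Φ j

reorient : ∀ {m} → (Fin m → Bool) → Bool × Fin m → Fin m → Bool
reorient Φ (σ , j) = updateAt Φ j (const σ)

agrees-reorient-self : ∀ {m} (Φ : Fin m → Bool) τ → Agrees (reorient Φ τ) τ
agrees-reorient-self Φ (σ , j) = sym (updateAt-updates j Φ)

agrees-reorient : ∀ {m} {Φ : Fin m → Bool} {τ} τ′ → Agrees Φ τ′ → τ′ ≢ opposite τ →
                  Agrees (reorient Φ τ) τ′
agrees-reorient {Φ = Φ} {σ , j} (σ′ , j′) σ′≡Φj′ τ′≢τ̄ with j′ ≟ j
... | yes refl = trans (Boolₚ.¬-not (λ σ′≡σ̄ → τ′≢τ̄ (cong (_, j) σ′≡σ̄)))
  (trans (Boolₚ.not-involutive σ) (sym (updateAt-updates j Φ)))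
... | no j′≢j = trans σ′≡Φj′ (sym (updateAt-minimal j′ j Φ j′≢j))

δ-conformal : ∀ {m} (Φ : Fin m → Bool) τ → Agrees Φ τ → ∀ i → Conformal (δ τ i) (sg (Φ i))
δ-conformal Φ (σ , j) σ≡Φj i with i ≟ j
... | yes refl rewrite σ≡Φj = conformal-refl (sg (Φ i))
... | no _     = conformal-0 (sg (Φ i))

norm1-δ+δ : ∀ {m} (Φ : Fin m → Bool) τ τ′ → Agrees Φ τ → Agrees Φ τ′ →
            norm1 (λ i → δ τ i + δ τ′ i) ≡ 2
norm1-δ+δ Φ τ τ′ τ∼Φ τ′∼Φ = cong ∣_∣ (begin
  sumℤ (λ i → + ∣ δ τ i + δ τ′ i ∣)       ≡⟨ sumℤ-cong (λ i → cong +_ (∣+∣-conformal (δτ≼ i) (δτ′≼ i))) ⟩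
  sumℤ (λ i → ∣δτ∣ i + ∣δτ′∣ i)           ≡⟨ sumℤ-+ ∣δτ∣ ∣δτ′∣ ⟩
  sumℤ ∣δτ∣ + sumℤ ∣δτ′∣                  ≡⟨ cong₂ _+_ (sumℤ-∣δ∣ τ) (sumℤ-∣δ∣ τ′) ⟩
  + 2                                     ∎)
  where
  δτ≼  = δ-conformal Φ τ τ∼Φ
  δτ′≼ = δ-conformal Φ τ′ τ′∼Φ
  ∣δτ∣ ∣δτ′∣ : Fin _ → ℤ
  ∣δτ∣ i = + ∣ δ τ i ∣
  ∣δτ′∣ i = + ∣ δ τ′ i ∣

-- Peeling signed unit vectors off a conformal vector

∥_∥ : ∀ {n} → (Fin n → ℤ) → ℕ
∥ a ∥ = ℕΣ.sum (λ e → ∣ a e ∣)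

∥∥-updateAt : ∀ {n} (a : Fin n → ℤ) (e : Fin n) {a′ : ℤ} → ∣ a e ∣ ≡ suc ∣ a′ ∣ →
              ∥ a ∥ ≡ suc ∥ updateAt a e (const a′) ∥
∥∥-updateAt {suc n} a e {a′} ∣ae∣≡ = begin
  ∥ a ∥                                      ≡⟨ ℕΣ.sum-remove {i = e} ∣a∣ ⟩
  ∣ a e ∣ ℕ.+ ℕΣ.sum (removeAt ∣a∣ e)        ≡⟨ cong₂ ℕ._+_ ∣ae∣≡ (ℕΣ.sum-cong-≗ unchanged) ⟩
  suc ∣ a′ ∣ ℕ.+ ℕΣ.sum (removeAt ∣b∣ e)     ≡⟨ cong (λ x → suc (∣ x ∣ ℕ.+ ℕΣ.sum (removeAt ∣b∣ e)))
                                                     (updateAt-updates e a) ⟨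
  suc (∣ b e ∣ ℕ.+ ℕΣ.sum (removeAt ∣b∣ e))  ≡⟨ cong suc (ℕΣ.sum-remove {i = e} ∣b∣) ⟨
  suc ∥ b ∥                                  ∎
  where
  b : Fin (suc n) → ℤ
  b = updateAt a e (const a′)
  ∣a∣ ∣b∣ : Fin (suc n) → ℕ
  ∣a∣ k = ∣ a k ∣
  ∣b∣ k = ∣ b k ∣
  unchanged : ∀ k → ∣a∣ (punchIn e k) ≡ ∣b∣ (punchIn e k)
  unchanged k = cong ∣_∣ (sym (updateAt-minimal (punchIn e k) e a (Finₚ.punchInᵢ≢i e k)))

unit-step : ∀ a → a ≢ + 0 → Σ Bool λ s → Σ ℤ λ a′ →
  a ≡ a′ + sg s × ∣ a ∣ ≡ suc ∣ a′ ∣ × (∀ {t} → Conformal a t → Conformal a′ t × Conformal (sg s) t)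
unit-step (+ zero) a≢0 = contradiction refl a≢0
unit-step +[1+ j ] _ = true , + j , cong +_ (ℕₚ.+-comm 1 j) , refl ,
  λ a≼t → conformal-pos a≼t (+≤+ ℕ.z≤n) , conformal-pos a≼t (+≤+ ℕ.z≤n)
unit-step -[1+ j ] _ = false , - + j , trans (ℤₚ.neg-suc j) (ℤₚ.+-comm -[1+ 0 ] (- + j)) ,
  cong suc (sym (ℤₚ.∣-i∣≡∣i∣ (+ j))) ,
  λ a≼t → conformal-neg a≼t (ℤₚ.neg-mono-≤ (+≤+ ℕ.z≤n)) , conformal-neg a≼t -≤+

updateAt-δ-split : ∀ {n} (a : Fin n → ℤ) e {s a′} → a e ≡ a′ + sg s →
                   ∀ e′ → a e′ ≡ updateAt a e (const a′) e′ + δ (s , e) e′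
updateAt-δ-split a e {s} ae≡ e′ with e′ ≟ e
... | yes refl = trans ae≡ (cong (_+ sg s) (sym (updateAt-updates e a)))
... | no e′≢e  = trans (sym (ℤₚ.+-identityʳ (a e′)))
                       (cong (λ x → x + + 0) (sym (updateAt-minimal e′ e a e′≢e)))

conformal-updateAt : ∀ {n} (Y a : Fin n → ℤ) e {a′} → (∀ e → Conformal (a e) (Y e)) →
  Conformal a′ (Y e) → ∀ e′ → Conformal (updateAt a e (const a′) e′) (Y e′)
conformal-updateAt Y a e a≼Y a′≼Y e′ with e′ ≟ e
... | yes refl = subst (λ x → Conformal x (Y e)) (sym (updateAt-updates e a)) a′≼Y
... | no e′≢e  = subst (λ x → Conformal x (Y e′)) (sym (updateAt-minimal e′ e a e′≢e)) (a≼Y e′)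

conformal-δ : ∀ {n} (Y : Fin n → ℤ) s e → Conformal (sg s) (Y e) → ∀ e′ → Conformal (δ (s , e) e′) (Y e′)
conformal-δ Y s e sg≼Y e′ with e′ ≟ e
... | yes refl = sg≼Y
... | no _     = conformal-0 (Y e′)

conformal-induction : ∀ {n} (Y : Fin n → ℤ) (P : (Fin n → ℤ) → Set) →
  (∀ a → (∀ e → a e ≡ + 0) → P a) →
  (∀ a b s e → (∀ e′ → Conformal (δ (s , e) e′) (Y e′)) →
     (∀ e′ → a e′ ≡ b e′ + δ (s , e) e′) → P b → P a) →
  ∀ a → (∀ e → Conformal (a e) (Y e)) → P a
conformal-induction {n} Y P base step a a≼Y = go ∥ a ∥ a refl a≼Y
  where
  go : ∀ k a → ∥ a ∥ ≡ k → (∀ e → Conformal (a e) (Y e)) → P a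
  go k a ∥a∥≡k a≼Y with Finₚ.all? (λ e → a e ℤ.≟ + 0)
  ... | yes a≡0 = base a a≡0
  ... | no a≢0 with Finₚ.¬∀⟶∃¬ n _ (λ e → a e ℤ.≟ + 0) a≢0
  ...   | e , ae≢0 with unit-step (a e) ae≢0
  ...     | s , a′ , ae≡ , ∣ae∣≡ , split≼ = descend k (trans (sym (∥∥-updateAt a e ∣ae∣≡)) ∥a∥≡k)
    where
    descend : ∀ k → suc ∥ updateAt a e (const a′) ∥ ≡ k → P a
    descend zero    ()
    descend (suc k) ∥a∥≡1+k = step a _ s e
      (conformal-δ Y s e (proj₂ (split≼ (a≼Y e))))
      (updateAt-δ-split a e ae≡)
      (go k _ (ℕₚ.suc-injective ∥a∥≡1+k) (conformal-updateAt Y a e a≼Y (proj₁ (split≼ (a≼Y e)))))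

-- Conformal decomposition along the graph

_≟ᵗ_ : ∀ {m} (τ τ′ : Bool × Fin m) → Dec (τ ≡ τ′)
_≟ᵗ_ = ×ₚ.≡-dec Boolₚ._≟_ _≟_

module Decomposition {m n} (M : Fin m → Fin n → ℤ) (u v : Fin n → Fin m)
  (u≢v : ∀ e → u e ≢ v e) (M≡incidence : ∀ i e → M i e ≡ incidenceEntry u v i e)
  (Y : Fin n → ℤ) where

  record Piece : Set where
    constructor piece
    field
      q : Fin n → ℤ
      t₁ t₂ : Bool × Fin m
      M·q : ∀ i → M i · q ≡ δ t₁ i + δ t₂ i
      q≼Y : ∀ e → Conformal (q e) (Y e)
  open Piece public

  flip : Piece → Piece
  flip x = piece (q x) (t₂ x) (t₁ x) (λ i → trans (M·q x i) (ℤₚ.+-comm (δ (t₁ x) i) _)) (q≼Y x)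

  join : (x y : Piece) → t₁ y ≡ opposite (t₁ x) → Piece
  join x y t₁y≡t̄₁x =
    piece (λ e → q x e + q y e) (t₂ x) (t₂ y) M·q′ (λ e → conformal-+ (q≼Y x e) (q≼Y y e))
    where
    cancel : ∀ a b a′ c → a + a′ ≡ + 0 → (a + b) + (a′ + c) ≡ b + c
    cancel a b a′ c a+a′≡0 =
      trans (regroup a b a′ c) (trans (cong (_+ (b + c)) a+a′≡0) (ℤₚ.+-identityˡ (b + c)))
      where
      regroup : ∀ a b a′ c → (a + b) + (a′ + c) ≡ (a + a′) + (b + c)
      regroup = solve-∀
    t₁-cancel : ∀ i → δ (t₁ x) i + δ (t₁ y) i ≡ + 0
    t₁-cancel i = trans (cong (λ τ → δ (t₁ x) i + δ τ i) t₁y≡t̄₁x) (δ-opposite (t₁ x) i)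
    M·q′ : ∀ i → M i · (λ e → q x e + q y e) ≡ δ (t₂ x) i + δ (t₂ y) i
    M·q′ i = begin
      M i · (λ e → q x e + q y e)                           ≡⟨ ·-+ (M i) (q x) (q y) ⟩
      M i · q x + M i · q y                                 ≡⟨ cong₂ _+_ (M·q x i) (M·q y i) ⟩
      (δ (t₁ x) i + δ (t₂ x) i) + (δ (t₁ y) i + δ (t₂ y) i) ≡⟨ cancel (δ (t₁ x) i) _ (δ (t₁ y) i) _ (t₁-cancel i) ⟩
      δ (t₂ x) i + δ (t₂ y) i                               ∎

  edge : ∀ s e → (∀ e′ → Conformal (δ (s , e) e′) (Y e′)) → Piece
  edge s e δ≼Y = piece (δ (s , e)) (s , u e) (s , v e) M·δ δ≼Y
    where
    M·δ : ∀ i → M i · δ (s , e) ≡ δ (s , u e) i + δ (s , v e) i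
    M·δ i = trans (·-δ (M i) s e)
      (trans (cong (_* sg s) (M≡incidence i e)) (incidenceEntry-δ u v e (u≢v e) s i))

  BothAgree : (Fin m → Bool) → Piece → Set
  BothAgree Φ x = Agrees Φ (t₁ x) × Agrees Φ (t₂ x)

  Avoids : Bool × Fin m → Piece → Set
  Avoids τ x = t₁ x ≢ τ × t₂ x ≢ τ

  qsum : List Piece → Fin n → ℤ
  qsum []       e = + 0
  qsum (x ∷ xs) e = q x e + qsum xs e

  qsum-lookup : ∀ xs e → qsum xs e ≡ sumℤ (λ k → q (lookup xs k) e)
  qsum-lookup []       e = refl
  qsum-lookup (x ∷ xs) e = cong (_+_ (q x e)) (qsum-lookup xs e)

  data Remove : List Piece → Piece → List Piece → Set where
    here  : ∀ {x xs} → Remove (x ∷ xs) x xs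
    here˘ : ∀ {x xs} → Remove (x ∷ xs) (flip x) xs
    there : ∀ {x y xs ys} → Remove xs x ys → Remove (y ∷ xs) x (y ∷ ys)

  qsum-remove : ∀ {xs x ys} → Remove xs x ys → ∀ e → qsum xs e ≡ q x e + qsum ys e
  qsum-remove here      e = refl
  qsum-remove here˘     e = refl
  qsum-remove {x = x} (there {y = y} r) e =
    trans (cong (_+_ (q y e)) (qsum-remove r e)) (x∙yz≈y∙xz (q y e) (q x e) _)

  agree-remove : ∀ {Φ xs x ys} → Remove xs x ys → All (BothAgree Φ) xs →
                 BothAgree Φ x × All (BothAgree Φ) ys
  agree-remove here      (x∼Φ ∷ xs∼Φ)             = x∼Φ , xs∼Φ
  agree-remove here˘     ((t₁∼Φ , t₂∼Φ) ∷ xs∼Φ)   = (t₂∼Φ , t₁∼Φ) , xs∼Φ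
  agree-remove (there r) (y∼Φ ∷ xs∼Φ)             =
    proj₁ (agree-remove r xs∼Φ) , y∼Φ ∷ proj₂ (agree-remove r xs∼Φ)

  Found : Bool × Fin m → List Piece → Set
  Found τ xs = ∃₂ λ x ys → Remove xs x ys × t₁ x ≡ τ

  find : ∀ τ xs → Found τ xs ⊎ All (Avoids τ) xs
  find τ [] = inj₂ []
  find τ (x ∷ xs) with t₁ x ≟ᵗ τ | t₂ x ≟ᵗ τ
  ... | yes t₁≡τ | _        = inj₁ (x , xs , here , t₁≡τ)
  ... | no _     | yes t₂≡τ = inj₁ (flip x , xs , here˘ , t₂≡τ)
  ... | no t₁≢τ  | no t₂≢τ  with find τ xs
  ...   | inj₁ (y , ys , r , t₁y≡τ) = inj₁ (y , x ∷ ys , there r , t₁y≡τ)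
  ...   | inj₂ xs-avoid             = inj₂ ((t₁≢τ , t₂≢τ) ∷ xs-avoid)

  -- Terminals agreeing with a common orientation never cancel each other.
  record State : Set where
    field
      pieces : List Piece
      circulation : Fin n → ℤ
      orientation : Fin m → Bool
      pieces-agree : All (BothAgree orientation) pieces
      circulation≼Y : ∀ e → Conformal (circulation e) (Y e)
      M·circulation : ∀ i → M i · circulation ≡ + 0
  open State public

  total : State → Fin n → ℤ
  total S e = qsum (pieces S) e + circulation S e

  Extension : State → (Fin n → ℤ) → Set
  Extension S a = Σ State λ S′ → ∀ e → total S′ e ≡ total S e + a e

  empty : State
  empty = record
    { pieces = [] ; circulation = const (+ 0) ; orientation = const true ; pieces-agree = []
    ; circulation≼Y = λ e → conformal-0 (Y e) ; M·circulation = λ i → ·-zero (M i) }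

  push : (S : State) (x : Piece) → BothAgree (orientation S) x → Extension S (q x)
  push S x x∼Φ = record S { pieces = x ∷ pieces S ; pieces-agree = x∼Φ ∷ pieces-agree S } ,
    λ e → rotate (q x e) (qsum (pieces S) e) (circulation S e)
    where
    rotate : ∀ a b c → (a + b) + c ≡ (b + c) + a
    rotate = solve-∀

  absorb : (S : State) (x : Piece) → t₂ x ≡ opposite (t₁ x) → Extension S (q x)
  absorb S x t₂≡t̄₁ = record S
    { circulation = λ e → circulation S e + q x e
    ; circulation≼Y = λ e → conformal-+ (circulation≼Y S e) (q≼Y x e)
    ; M·circulation = λ i → trans (·-+ (M i) (circulation S) (q x))
                             (cong₂ _+_ (M·circulation S i) (M·q≡0 i)) } ,
    λ e → sym (ℤₚ.+-assoc (qsum (pieces S) e) (circulation S e) (q x e))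
    where
    M·q≡0 : ∀ i → M i · q x ≡ + 0
    M·q≡0 i = trans (M·q x i) (trans (cong (λ τ → δ (t₁ x) i + δ τ i) t₂≡t̄₁) (δ-opposite (t₁ x) i))

  _∖_ : (S : State) {x : Piece} {ys : List Piece} → Remove (pieces S) x ys → State
  S ∖ r = record S { pieces = _ ; pieces-agree = proj₂ (agree-remove r (pieces-agree S)) }

  removed-agrees : (S : State) {x : Piece} {ys : List Piece} → Remove (pieces S) x ys →
                   BothAgree (orientation S) x
  removed-agrees S r = proj₁ (agree-remove r (pieces-agree S))

  through-removal : (S : State) {x : Piece} {ys : List Piece} (r : Remove (pieces S) x ys) {a : Fin n → ℤ} →
                    Extension (S ∖ r) (λ e → a e + q x e) → Extension S a
  through-removal S {x} {ys} r {a} (S′ , S′≡S∖r+a+x) = S′ , λ e → begin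
    total S′ e                                     ≡⟨ S′≡S∖r+a+x e ⟩
    (qsum ys e + circulation S e) + (a e + q x e)  ≡⟨ regroup (qsum ys e) (circulation S e) (a e) (q x e) ⟩
    (q x e + qsum ys e + circulation S e) + a e    ≡⟨ cong (λ t → t + circulation S e + a e) (qsum-remove r e) ⟨
    total S e + a e                                ∎
    where
    regroup : ∀ b c a x → (b + c) + (a + x) ≡ (x + b + c) + a
    regroup = solve-∀

  reorient-state : (S : State) (τ : Bool × Fin m) → All (Avoids (opposite τ)) (pieces S) → State
  reorient-state S τ avoid = record S
    { orientation = reorient (orientation S) τ
    ; pieces-agree = All.zipWith (λ ((t₁∼Φ , t₂∼Φ) , (t₁≢τ̄ , t₂≢τ̄)) →
        agrees-reorient _ t₁∼Φ t₁≢τ̄ , agrees-reorient _ t₂∼Φ t₂≢τ̄) (pieces-agree S , avoid) }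

  resolve : (S : State) (x : Piece) → Agrees (orientation S) (t₂ x) → Extension S (q x)
  resolve S x t₂∼Φ with t₂ x ≟ᵗ opposite (t₁ x)
  ... | yes closed = absorb S x closed
  ... | no not-closed with find (opposite (t₁ x)) (pieces S)
  ...   | inj₁ (y , ys , r , t₁y≡t̄₁x) =
          through-removal S r (push (S ∖ r) (join x y t₁y≡t̄₁x) (t₂∼Φ , proj₂ (removed-agrees S r)))
  ...   | inj₂ avoid = push (reorient-state S (t₁ x) avoid) x
          (agrees-reorient-self (orientation S) (t₁ x) , agrees-reorient (t₂ x) t₂∼Φ not-closed)

  insert-edge : (S : State) (s : Bool) (e : Fin n) (δ≼Y : ∀ e′ → Conformal (δ (s , e) e′) (Y e′)) →
                Extension S (δ (s , e))
  insert-edge S s e δ≼Y with find (opposite (s , u e)) (pieces S)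
  ... | inj₁ (y , ys , r , t₁y≡t̄) =
        through-removal S r (resolve (S ∖ r) (join (edge s e δ≼Y) y t₁y≡t̄) (proj₂ (removed-agrees S r)))
  ... | inj₂ avoid = resolve (reorient-state S (s , u e) avoid) (flip (edge s e δ≼Y))
        (agrees-reorient-self (orientation S) (s , u e))

  conformal-decomposition : Σ State λ S → ∀ e → total S e ≡ Y e
  conformal-decomposition = conformal-induction Y (λ a → Σ State λ S → ∀ e → total S e ≡ a e)
    (λ a a≡0 → empty , λ e → sym (a≡0 e))
    (λ a b s e δ≼Y a≡b+δ (S , S≡b) → let (S′ , S′≡S+δ) = insert-edge S s e δ≼Y in
      S′ , λ e′ → trans (S′≡S+δ e′) (trans (cong (_+ δ (s , e) e′) (S≡b e′)) (sym (a≡b+δ e′))))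
    Y (λ e → conformal-refl (Y e))

+-cancelˡ-≤ : ∀ a {b c} → a + b ≤ a + c → b ≤ c
+-cancelˡ-≤ a {b} {c} a+b≤a+c = subst₂ _≤_ (cancel a b) (cancel a c) (ℤₚ.+-monoʳ-≤ (- a) a+b≤a+c)
  where
  cancel : ∀ a x → - a + (a + x) ≡ x
  cancel = solve-∀

module _ {m n} (M : Fin m → Fin n → ℤ) (c : Fin n → ℤ) where

  feasible-∣∣ : ∀ {z} (X : Fin n → ℤ) → (∀ e → + 0 ≤ X e) → (∀ i → M i · X ≡ z i) →
                Feasible M z (λ e → ∣ X e ∣)
  feasible-∣∣ X X≥0 M·X≡z i = trans (·-∣∣ (M i) X X≥0) (M·X≡z i)

  min-just-≤ : ∀ {z r} → IsMinValue c M z (just r) → (X : Fin n → ℤ) → (∀ e → + 0 ≤ X e) →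
               (∀ i → M i · X ≡ z i) → r ≤ c · X
  min-just-≤ {r = r} (_ , r≤cost) X X≥0 M·X≡z =
    subst (r ≤_) (·-∣∣ c X X≥0) (r≤cost _ (feasible-∣∣ X X≥0 M·X≡z))

  min-≤ : ∀ {z o} → IsMinValue c M z o → (X : Fin n → ℤ) → (∀ e → + 0 ≤ X e) →
          (∀ i → M i · X ≡ z i) → Σ ℤ λ r → o ≡ just r × r ≤ c · X
  min-≤ {o = nothing} infeasible X X≥0 M·X≡z = ⊥-elim (infeasible (_ , feasible-∣∣ X X≥0 M·X≡z))
  min-≤ {o = just r}  r-min      X X≥0 M·X≡z = r , refl , min-just-≤ r-min X X≥0 M·X≡z

  balanced-cost-zero : ∀ {z₁ z₂ r₁ r₂} → IsMinValue c M z₁ (just r₁) → IsMinValue c M z₂ (just r₂) →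
    ∀ {A B w : Fin n → ℤ} → (∀ i → M i · A ≡ z₁ i) → c · A ≡ r₁ →
    (∀ i → M i · (λ e → B e + w e) ≡ z₂ i) → c · (λ e → B e + w e) ≡ r₂ →
    (∀ i → M i · w ≡ + 0) → (∀ e → + 0 ≤ A e + w e) → (∀ e → + 0 ≤ B e) → c · w ≡ + 0
  balanced-cost-zero {z₁} {z₂} {r₁} {r₂} min₁ min₂ {A} {B} {w} M·A c·A M·[B+w] c·[B+w] M·w A+w≥0 B≥0 =
    ℤₚ.≤-antisym c·w≤0 0≤c·w
    where
    0≤c·w : + 0 ≤ c · w
    0≤c·w = +-cancelˡ-≤ r₁ (subst₂ _≤_ (sym (ℤₚ.+-identityʳ r₁))
      (trans (·-+ c A w) (cong (_+ c · w) c·A))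
      (min-just-≤ min₁ (λ e → A e + w e) A+w≥0
        (λ i → trans (·-+ (M i) A w) (trans (cong₂ _+_ (M·A i) (M·w i)) (ℤₚ.+-identityʳ (z₁ i))))))
    c·w≤0 : c · w ≤ + 0
    c·w≤0 = +-cancelˡ-≤ (c · B) (subst₂ _≤_
      (trans (sym c·[B+w]) (·-+ c B w))
      (sym (ℤₚ.+-identityʳ (c · B)))
      (min-just-≤ min₂ B B≥0
        (λ i → trans (sym (trans (cong (_+_ (M i · B)) (M·w i)) (ℤₚ.+-identityʳ (M i · B))))
                     (trans (sym (·-+ (M i) B w)) (M·[B+w] i)))))

-- The exchange property

ExchangeWitness : ∀ {m} → (Vecℤ m → Maybe ℚ) → Vecℤ m → Vecℤ m → ℚ → ℚ → Set
ExchangeWitness {m} f z₁ z₂ v₁ v₂ = Σ ℕ λ ℓ → Σ (Fin ℓ → Vecℤ m) λ p → Σ (Fin ℓ → ℚ) λ g →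
  IsTwoStepDecomposition (λ i → z₂ i ℤ.- z₁ i) p
  × v₂ ≡ v₁ ℚ.+ sumℚ g
  × (∀ (I : Fin ℓ → Bool) → Σ ℚ λ w →
       (f (λ i → z₁ i ℤ.+ sumSub I p i) ≡ just w) × (w ℚ.≤ v₁ ℚ.+ sumSubℚ I g))

module Exchange {m n} (M : Fin m → Fin n → ℤ) (c : Fin n → ℤ)
  (u v : Fin n → Fin m) (u≢v : ∀ e → u e ≢ v e) (M≡incidence : ∀ i e → M i e ≡ incidenceEntry u v i e)
  (f : Vecℤ m → Maybe ℤ) (f-min : ∀ z → IsMinValue c M z (f z))
  {z₁ z₂ : Vecℤ m} {r₁ r₂ : ℤ} (min₁ : IsMinValue c M z₁ (just r₁)) (min₂ : IsMinValue c M z₂ (just r₂))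
  where

  X₁ X₂ Y : Fin n → ℤ
  X₁ e = + proj₁ (proj₁ min₁) e
  X₂ e = + proj₁ (proj₁ min₂) e
  Y e = X₂ e - X₁ e

  M·X₁ : ∀ i → M i · X₁ ≡ z₁ i
  M·X₁ = proj₁ (proj₂ (proj₁ min₁))

  c·X₁ : c · X₁ ≡ r₁
  c·X₁ = proj₂ (proj₂ (proj₁ min₁))

  M·X₂ : ∀ i → M i · X₂ ≡ z₂ i
  M·X₂ = proj₁ (proj₂ (proj₁ min₂))

  c·X₂ : c · X₂ ≡ r₂
  c·X₂ = proj₂ (proj₂ (proj₁ min₂))

  open Decomposition M u v u≢v M≡incidence Y

  S : State
  S = proj₁ conformal-decomposition

  w : Fin n → ℤ
  w = circulation S

  ℓ : ℕ
  ℓ = length (pieces S)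

  P : Fin ℓ → Piece
  P = lookup (pieces S)

  p : Fin ℓ → Vecℤ m
  p k i = δ (t₁ (P k)) i + δ (t₂ (P k)) i

  cq : Fin ℓ → ℤ
  cq k = c · q (P k)

  g : Fin ℓ → ℚ
  g k = toℚ (cq k)

  Q : (Fin ℓ → Bool) → Fin n → ℤ
  Q I = sumSub I (q ∘ P)

  X : (Fin ℓ → Bool) → Fin n → ℤ
  X I e = X₁ e + (w e + Q I e)

  full : Fin ℓ → Bool
  full = const true

  Q≼Y : ∀ I e → Conformal (Q I e) (Y e)
  Q≼Y I e = conformal-sumSubℤ I (λ k → q (P k) e) (λ k → q≼Y (P k) e)

  Y≡Q+w : ∀ e → Y e ≡ Q full e + w e
  Y≡Q+w e = trans (sym (proj₂ conformal-decomposition e)) (cong (_+ w e) (qsum-lookup (pieces S) e))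

  X₁+Y≡X₂ : ∀ e → X₁ e + Y e ≡ X₂ e
  X₁+Y≡X₂ e = a+[b-a]≡b (X₁ e) (X₂ e)
    where
    a+[b-a]≡b : ∀ a b → a + (b - a) ≡ b
    a+[b-a]≡b = solve-∀

  X-full : ∀ e → X full e ≡ X₂ e
  X-full e =
    trans (cong (_+_ (X₁ e)) (trans (ℤₚ.+-comm (w e) (Q full e)) (sym (Y≡Q+w e)))) (X₁+Y≡X₂ e)

  between : ∀ {a b} e → Conformal a (Y e) → Conformal b (Y e) → a + b ≡ Y e → + 0 ≤ X₁ e + a
  between e = conformal-partial-nonneg (+≤+ ℕ.z≤n) (subst (+ 0 ≤_) (sym (X₁+Y≡X₂ e)) (+≤+ ℕ.z≤n))

  X-nonneg : ∀ I e → + 0 ≤ X I e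
  X-nonneg I e = between e (conformal-+ (circulation≼Y S e) (Q≼Y I e)) (Q≼Y (not ∘ I) e) (begin
    (w e + Q I e) + Q (not ∘ I) e   ≡⟨ ℤₚ.+-assoc (w e) _ _ ⟩
    w e + (Q I e + Q (not ∘ I) e)   ≡⟨ cong (_+_ (w e)) (sumSubℤ-complement I (λ k → q (P k) e)) ⟩
    w e + Q full e                  ≡⟨ ℤₚ.+-comm (w e) _ ⟩
    Q full e + w e                  ≡⟨ Y≡Q+w e ⟨
    Y e                             ∎)

  ·X : ∀ a I → a · X I ≡ a · X₁ + (a · w + sumSubℤ I (λ k → a · q (P k)))
  ·X a I = trans (·-+ a X₁ _) (cong (_+_ (a · X₁))
    (trans (·-+ a w (Q I)) (cong (_+_ (a · w)) (·-sumSub a I (q ∘ P)))))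

  M·X : ∀ I i → M i · X I ≡ z₁ i + sumSub I p i
  M·X I i = begin
    M i · X I                                                     ≡⟨ ·X (M i) I ⟩
    M i · X₁ + (M i · w + sumSubℤ I (λ k → M i · q (P k)))        ≡⟨ cong₂ _+_ (M·X₁ i)
                                                                       (cong₂ _+_ (M·circulation S i)
                                                                         (sumSubℤ-cong I (λ k → M·q (P k) i))) ⟩
    z₁ i + (+ 0 + sumSub I p i)                                   ≡⟨ cong (_+_ (z₁ i)) (ℤₚ.+-identityˡ _) ⟩
    z₁ i + sumSub I p i                                           ∎

  c·w≡0 : c · w ≡ + 0
  c·w≡0 = balanced-cost-zero M c min₁ min₂ {B = λ e → X₁ e + Q full e}
    M·X₁ c·X₁ (λ i → trans (·-cong (M i) B+w≡X₂) (M·X₂ i)) (trans (·-cong c B+w≡X₂) c·X₂)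
    (M·circulation S)
    (λ e → between e (circulation≼Y S e) (Q≼Y full e) (trans (ℤₚ.+-comm (w e) _) (sym (Y≡Q+w e))))
    (λ e → between e (Q≼Y full e) (circulation≼Y S e) (sym (Y≡Q+w e)))
    where
    B+w≡X₂ : ∀ e → (X₁ e + Q full e) + w e ≡ X₂ e
    B+w≡X₂ e = trans (ℤₚ.+-assoc (X₁ e) (Q full e) (w e))
      (trans (cong (_+_ (X₁ e)) (ℤₚ.+-comm (Q full e) (w e))) (X-full e))

  c·X : ∀ I → c · X I ≡ r₁ + sumSubℤ I cq
  c·X I = trans (·X c I)
    (cong₂ _+_ c·X₁ (trans (cong (_+ sumSubℤ I cq) c·w≡0) (ℤₚ.+-identityˡ (sumSubℤ I cq))))

  z₂-z₁≡∑p : ∀ i → z₂ i - z₁ i ≡ sumℤ (λ k → p k i)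
  z₂-z₁≡∑p i = begin
    z₂ i - z₁ i                          ≡⟨ cong (_- z₁ i) (sym (M·X₂ i)) ⟩
    M i · X₂ - z₁ i                      ≡⟨ cong (_- z₁ i) (·-cong (M i) (sym ∘ X-full)) ⟩
    M i · X full - z₁ i                  ≡⟨ cong (_- z₁ i) (M·X full i) ⟩
    (z₁ i + sumℤ (λ k → p k i)) - z₁ i   ≡⟨ [a+b]-a≡b (z₁ i) _ ⟩
    sumℤ (λ k → p k i)                   ∎
    where
    [a+b]-a≡b : ∀ a b → (a + b) - a ≡ b
    [a+b]-a≡b = solve-∀

  p-agree : ∀ k → BothAgree (orientation S) (P k)
  p-agree k = All.lookup (pieces-agree S) (∈-lookup k)

  p⊑z₂-z₁ : ∀ k → p k ⊑ (λ i → z₂ i - z₁ i)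
  p⊑z₂-z₁ k i = subst (λ d → (∣ p k i ∣ ℕ.≤ ∣ d ∣) × (+ 0 ≤ p k i * d)) (sym (z₂-z₁≡∑p i))
    (summand-⊑-sum (λ j → p j i) (sg (orientation S i)) p≼ k)
    where
    p≼ : ∀ j → Conformal (p j i) (sg (orientation S i))
    p≼ j = conformal-+ (δ-conformal _ (t₁ (P j)) (proj₁ (p-agree j)) i)
                       (δ-conformal _ (t₂ (P j)) (proj₂ (p-agree j)) i)

  value : toℚ r₂ ≡ toℚ r₁ ℚ.+ sumℚ g
  value = begin
    toℚ r₂                                  ≡⟨ cong toℚ (sym c·X₂) ⟩
    toℚ (c · X₂)                            ≡⟨ cong toℚ (·-cong c (sym ∘ X-full)) ⟩
    toℚ (c · X full)                        ≡⟨ cong toℚ (c·X full) ⟩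
    toℚ (r₁ + sumSubℤ full cq)              ≡⟨ toℚ-+ r₁ _ ⟩
    toℚ r₁ ℚ.+ toℚ (sumSubℤ full cq)        ≡⟨ cong (toℚ r₁ ℚ.+_) (toℚ-sumSubℤ full cq) ⟩
    toℚ r₁ ℚ.+ sumℚ g                       ∎

  subset-value : ∀ I → Σ ℚ λ v → (map toℚ (f (λ i → z₁ i + sumSub I p i)) ≡ just v) ×
                                (v ℚ.≤ toℚ r₁ ℚ.+ sumSubℚ I g)
  subset-value I = conclude (min-≤ M c (f-min _) (X I) (X-nonneg I) (M·X I))
    where
    bound : toℚ (r₁ + sumSubℤ I cq) ≡ toℚ r₁ ℚ.+ sumSubℚ I g
    bound = trans (toℚ-+ r₁ _) (cong (toℚ r₁ ℚ.+_) (toℚ-sumSubℤ I cq))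
    conclude : Σ ℤ (λ r → f (λ i → z₁ i + sumSub I p i) ≡ just r × r ≤ c · X I) →
               Σ ℚ λ v → (map toℚ (f (λ i → z₁ i + sumSub I p i)) ≡ just v) ×
                         (v ℚ.≤ toℚ r₁ ℚ.+ sumSubℚ I g)
    conclude (r , fz≡r , r≤c·X) =
      toℚ r , cong (map toℚ) fz≡r , subst (toℚ r ℚ.≤_) bound (toℚ-mono-≤ (subst (r ≤_) (c·X I) r≤c·X))

  exchange : ExchangeWitness (λ z → map toℚ (f z)) z₁ z₂ (toℚ r₁) (toℚ r₂)
  exchange = ℓ , p , g ,
    ((λ k → norm1-δ+δ (orientation S) (t₁ (P k)) (t₂ (P k)) (proj₁ (p-agree k)) (proj₂ (p-agree k))) ,
     p⊑z₂-z₁ , λ i → z₂-z₁≡∑p i) ,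
    value , subset-value

map-≡-just : ∀ {A B : Set} {h : A → B} (o : Maybe A) {y : B} → map h o ≡ just y →
             Σ A λ x → o ≡ just x × h x ≡ y
map-≡-just (just x) refl = x , refl , refl

proposition17 : (m n : ℕ) (M : Fin m → Fin n → ℤ) (c : Fin n → ℤ) →
    IsSimpleGraphIncidence M →
    (f : Vecℤ m → Maybe ℤ) → (∀ z → IsMinValue c M z (f z)) →
    SBOJumpMConvex (λ z → map toℚ (f z))
proposition17 m n M c (u , v , u≢v , _ , M≡incidence) f f-min z₁ z₂ v₁ v₂ fz₁≡v₁ fz₂≡v₂
  with map-≡-just (f z₁) fz₁≡v₁ | map-≡-just (f z₂) fz₂≡v₂
... | r₁ , fz₁≡r₁ , refl | r₂ , fz₂≡r₂ , refl =
  Exchange.exchange M c u v u≢v M≡incidence f f-min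
    (subst (IsMinValue c M z₁) fz₁≡r₁ (f-min z₁)) (subst (IsMinValue c M z₂) fz₂≡r₂ (f-min z₂))
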